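{- For any Boolean function $\phi$ on $k$ inputs, $\mathrm{H}_\wedge(\phi)\le\mathrm{H}_{\deg}(\phi)$.
   Context: For $S\subseteq[k]$, an $S$-restriction of $\phi$ is obtained by fixing every input not in $S$ to a constant. And-hardness $\mathrm{H}_\wedge(\phi)$: the largest $h\in\{0,\dots,k\}$ such that for every $S\subseteq[k]$ with $|S|=h$ some $S$-restriction of $\phi$ has exactly one satisfying assignment ($\mathrm{H}_\wedge(\phi)=0$ for constant $\phi$). Degree hardness $\mathrm{H}_{\deg}(\phi)$: the largest $h$ such that for every $S\subseteq[k]$ with $|S|=h$ some $S$-restriction of $\phi$ has degree $h$, where the degree of a Boolean function is the degree of its unique multilinear real polynomial extension. -}

module Defs where

open import Data.Bool using (Bool; true; false; if_then_else_)
open import Data.Nat using (ℕ; zero; suc; _≤_; _<_; _⊔_)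
open import Data.Integer using (ℤ; _+_; _*_; 0ℤ; 1ℤ)
import Data.Integer as ℤ
open import Data.Fin using (Fin)
open import Data.Fin.Subset using (Subset; ∣_∣; _⊆_; _∈_)
open import Data.Vec using (Vec; []; _∷_; lookup)
open import Data.List using (List; []; _∷_; map; _++_; foldr)
open import Data.Product using (Σ; ∃; _×_; _,_)
open import Relation.Binary.PropositionalEquality using (_≡_)
open import Relation.Nullary using (¬_; does)

Assignment : ℕ → Set
Assignment k = Vec Bool k

BoolFn : ℕ → Set
BoolFn k = Assignment k → Bool

IsConstant : ∀ {k} → BoolFn k → Set
IsConstant {k} φ = Σ Bool λ b → ∀ (x : Assignment k) → φ x ≡ b

-- y is in the subcube obtained by fixing every coordinate outside S to c
Agrees : ∀ {k} → Subset k → Assignment k → Assignment k → Set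
Agrees {k} S c y = ∀ (i : Fin k) → lookup S i ≡ false → lookup y i ≡ lookup c i

UniqueSat : ∀ {k} → BoolFn k → Subset k → Assignment k → Set
UniqueSat {k} φ S c =
  Σ (Assignment k) λ y → (Agrees S c y × φ y ≡ true)
    × (∀ (z : Assignment k) → Agrees S c z → φ z ≡ true → z ≡ y)

allSubsets : (k : ℕ) → List (Subset k)
allSubsets zero = [] ∷ []
allSubsets (suc k) = map (true ∷_) (allSubsets k) ++ map (false ∷_) (allSubsets k)

-- multilinear polynomials with integer coefficients: coefficient of monomial ∏_{i∈T} x_i
Poly : ℕ → Set
Poly k = Subset k → ℤ

bit : Bool → ℤ
bit true = 1ℤ
bit false = 0ℤ

monomial : ∀ {k} → Subset k → Assignment k → ℤ
monomial [] [] = 1ℤ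
monomial (true ∷ T) (x ∷ xs) = bit x * monomial T xs
monomial (false ∷ T) (x ∷ xs) = monomial T xs

eval : ∀ {k} → Poly k → Assignment k → ℤ
eval {k} p x = foldr (λ T acc → p T * monomial T x + acc) 0ℤ (allSubsets k)

-- degree: max |T| over monomials with nonzero coefficient (zero polynomial has degree 0)
degree : ∀ {k} → Poly k → ℕ
degree {k} p =
  foldr (λ T acc → (if does (p T ℤ.≟ 0ℤ) then 0 else ∣ T ∣) ⊔ acc) 0 (allSubsets k)

-- p is the multilinear extension of the S-restriction of φ given by constants c:
-- p only involves variables in S and agrees with φ on the subcube.
IsRestrictionPoly : ∀ {k} → BoolFn k → Subset k → Assignment k → Poly k → Set
IsRestrictionPoly {k} φ S c p =
  (∀ (T : Subset k) → ¬ (p T ≡ 0ℤ) → T ⊆ S)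
  × (∀ (y : Assignment k) → Agrees S c y → eval p y ≡ bit (φ y))

RestrictionHasDegree : ∀ {k} → BoolFn k → Subset k → Assignment k → ℕ → Set
RestrictionHasDegree {k} φ S c d =
  Σ (Poly k) λ p → IsRestrictionPoly φ S c p × degree p ≡ d

AndHardAt : ∀ {k} → BoolFn k → ℕ → Set
AndHardAt {k} φ h =
  ∀ (S : Subset k) → ∣ S ∣ ≡ h → Σ (Assignment k) λ c → UniqueSat φ S c

DegHardAt : ∀ {k} → BoolFn k → ℕ → Set
DegHardAt {k} φ h =
  ∀ (S : Subset k) → ∣ S ∣ ≡ h → Σ (Assignment k) λ c → RestrictionHasDegree φ S c h

IsLargest : ℕ → (ℕ → Set) → ℕ → Set
IsLargest k P h = h ≤ k × P h × (∀ h' → h' ≤ k → P h' → h' ≤ h)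

IsAndHardness : ∀ {k} → BoolFn k → ℕ → Set
IsAndHardness {k} φ h =
  (IsConstant φ → h ≡ 0) × (¬ IsConstant φ → IsLargest k (AndHardAt φ) h)

IsDegHardness : ∀ {k} → BoolFn k → ℕ → Set
IsDegHardness {k} φ h = IsLargest k (DegHardAt φ) h

{-# OPTIONS --safe #-}
module Submission where

-- If the S-restriction of φ by c has a unique satisfying assignment y, then on that subcube
-- φ coincides with ∏_{i∈S} (xᵢ if yᵢ else 1 − xᵢ), a multilinear polynomial in the variables
-- of S whose top monomial ∏_{i∈S} xᵢ has coefficient ±1; so the restriction has degree |S|.
-- Hence and-hardness at any level h implies degree-hardness at level h.

open import Defs
open import Data.Nat using (ℕ; zero; suc; _≤_; z≤n; _⊔_)
import Data.Nat.Properties as ℕ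
open import Data.Bool using (Bool; true; false; _∧_; if_then_else_)
open import Data.Bool.Properties using (⇔→≡)
import Data.Bool as Bool
open import Data.Integer using (ℤ; _+_; _*_; 0ℤ; 1ℤ; -1ℤ)
import Data.Integer as ℤ
import Data.Integer.Properties as ℤ
open import Data.Integer.Tactic.RingSolver using (solve-∀)
open import Data.Fin using () renaming (zero to fzero; suc to fsuc)
open import Data.Fin.Subset using (Subset; ∣_∣; _⊆_; inside; outside)
open import Data.Fin.Subset.Properties using (⊆-refl; out⊆; s⊆s; p⊆q⇒∣p∣≤∣q∣)
open import Data.Vec using ([]; _∷_)
open import Data.List using (List; []; _∷_; map; _++_; foldr)
open import Data.List.Membership.Propositional as List using ()
open import Data.List.Membership.Propositional.Properties using (∈-map⁺; ∈-++⁺ˡ; ∈-++⁺ʳ)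
open import Data.List.Relation.Unary.Any using (here; there)
open import Data.Product using (_,_; proj₁; proj₂)
open import Data.Sum using ([_,_])
open import Data.Empty using (⊥-elim)
open import Function using (_∘_; mk⇔)
open import Relation.Binary.PropositionalEquality using (_≡_; _≢_; refl; sym; trans; cong; cong₂; subst; module ≡-Reasoning)
open import Relation.Nullary using (¬_; does; yes; no)

∑ : {A : Set} → List A → (A → ℤ) → ℤ
∑ xs f = foldr (λ a acc → f a + acc) 0ℤ xs

∑-++ : {A : Set} (xs ys : List A) (f : A → ℤ) → ∑ (xs ++ ys) f ≡ ∑ xs f + ∑ ys f
∑-++ []       ys f = sym (ℤ.+-identityˡ _)
∑-++ (x ∷ xs) ys f = trans (cong (f x +_) (∑-++ xs ys f)) (sym (ℤ.+-assoc (f x) _ _))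

∑-map : {A B : Set} (g : A → B) (xs : List A) (f : B → ℤ) → ∑ (map g xs) f ≡ ∑ xs (f ∘ g)
∑-map g []       f = refl
∑-map g (x ∷ xs) f = cong (f (g x) +_) (∑-map g xs f)

∑-cong : {A : Set} (xs : List A) {f g : A → ℤ} → (∀ a → f a ≡ g a) → ∑ xs f ≡ ∑ xs g
∑-cong []       f≗g = refl
∑-cong (x ∷ xs) f≗g = cong₂ _+_ (f≗g x) (∑-cong xs f≗g)

∑-*ˡ : {A : Set} (c : ℤ) (xs : List A) (f : A → ℤ) → ∑ xs (λ a → c * f a) ≡ c * ∑ xs f
∑-*ˡ c []       f = sym (ℤ.*-zeroʳ c)
∑-*ˡ c (x ∷ xs) f = trans (cong (c * f x +_) (∑-*ˡ c xs f)) (sym (ℤ.*-distribˡ-+ c (f x) _))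

∑-allSubsets : ∀ k (f : Subset (suc k) → ℤ) →
  ∑ (allSubsets (suc k)) f ≡ ∑ (allSubsets k) (f ∘ (inside ∷_)) + ∑ (allSubsets k) (f ∘ (outside ∷_))
∑-allSubsets k f = begin
  ∑ (map (inside ∷_) A ++ map (outside ∷_) A) f
    ≡⟨ ∑-++ (map (inside ∷_) A) _ f ⟩
  ∑ (map (inside ∷_) A) f + ∑ (map (outside ∷_) A) f
    ≡⟨ cong₂ _+_ (∑-map (inside ∷_) A f) (∑-map (outside ∷_) A f) ⟩
  ∑ A (f ∘ (inside ∷_)) + ∑ A (f ∘ (outside ∷_)) ∎
  where
  open ≡-Reasoning
  A = allSubsets k

∈-allSubsets : ∀ {k} (T : Subset k) → T List.∈ allSubsets k
∈-allSubsets         []          = here refl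
∈-allSubsets {suc k} (true  ∷ T) = ∈-++⁺ˡ (∈-map⁺ (inside ∷_) (∈-allSubsets T))
∈-allSubsets {suc k} (false ∷ T) =
  ∈-++⁺ʳ (map (inside ∷_) (allSubsets k)) (∈-map⁺ (outside ∷_) (∈-allSubsets T))

mulAffine : ∀ {k} → ℤ → ℤ → Poly k → Poly (suc k)
mulAffine α β p (true  ∷ T) = β * p T
mulAffine α β p (false ∷ T) = α * p T

eval-mulAffine : ∀ {k} α β (p : Poly k) a x →
  eval (mulAffine α β p) (a ∷ x) ≡ (α + β * bit a) * eval p x
eval-mulAffine {k} α β p a x = begin
  eval (mulAffine α β p) (a ∷ x)
    ≡⟨ ∑-allSubsets k (λ T → mulAffine α β p T * monomial T (a ∷ x)) ⟩
  ∑ A (λ T → β * p T * (bit a * monomial T x)) + ∑ A (λ T → α * p T * monomial T x)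
    ≡⟨ cong₂ _+_ (∑-cong A (λ T → regroup β (bit a) (p T) (monomial T x)))
                 (∑-cong A (λ T → ℤ.*-assoc α (p T) (monomial T x))) ⟩
  ∑ A (λ T → β * bit a * (p T * monomial T x)) + ∑ A (λ T → α * (p T * monomial T x))
    ≡⟨ cong₂ _+_ (∑-*ˡ (β * bit a) A _) (∑-*ˡ α A _) ⟩
  β * bit a * eval p x + α * eval p x
    ≡⟨ factor α β (bit a) (eval p x) ⟩
  (α + β * bit a) * eval p x ∎
  where
  open ≡-Reasoning
  A = allSubsets k
  regroup : ∀ b u c m → b * c * (u * m) ≡ b * u * (c * m)
  regroup = solve-∀
  factor : ∀ a b u e → b * u * e + a * e ≡ (a + b * u) * e
  factor = solve-∀

mulAffine-coeff≢0 : ∀ {k} α β (p : Poly k) t T → mulAffine α β p (t ∷ T) ≢ 0ℤ → p T ≢ 0ℤ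
mulAffine-coeff≢0 α β p true  T nz pT≡0 = nz (trans (cong (β *_) pT≡0) (ℤ.*-zeroʳ β))
mulAffine-coeff≢0 α β p false T nz pT≡0 = nz (trans (cong (α *_) pT≡0) (ℤ.*-zeroʳ α))

*-≢0 : ∀ i j → i ≢ 0ℤ → j ≢ 0ℤ → i * j ≢ 0ℤ
*-≢0 i j i≢0 j≢0 ij≡0 = [ i≢0 , j≢0 ] (ℤ.i*j≡0⇒i≡0∨j≡0 i ij≡0)

degreeOn : ∀ {k} → Poly k → List (Subset k) → ℕ
degreeOn p = foldr (λ T acc → (if does (p T ℤ.≟ 0ℤ) then 0 else ∣ T ∣) ⊔ acc) 0

degree≤ : ∀ {k} (p : Poly k) {n} → (∀ T → p T ≢ 0ℤ → ∣ T ∣ ≤ n) → degree p ≤ n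
degree≤ {k} p {n} bound = go (allSubsets k)
  where
  go : ∀ Ts → degreeOn p Ts ≤ n
  go []       = z≤n
  go (T ∷ Ts) with p T ℤ.≟ 0ℤ
  ... | yes _   = go Ts
  ... | no pT≢0 = ℕ.⊔-lub (bound T pT≢0) (go Ts)

≤degree : ∀ {k} (p : Poly k) T → p T ≢ 0ℤ → ∣ T ∣ ≤ degree p
≤degree {k} p T pT≢0 = go (allSubsets k) (∈-allSubsets T)
  where
  go : ∀ Ts → T List.∈ Ts → ∣ T ∣ ≤ degreeOn p Ts
  go (T ∷ Ts) (here refl) with p T ℤ.≟ 0ℤ
  ... | yes pT≡0 = ⊥-elim (pT≢0 pT≡0)
  ... | no _     = ℕ.m≤m⊔n _ _
  go (U ∷ Ts) (there T∈Ts) = ℕ.≤-trans (go Ts T∈Ts) (ℕ.m≤n⊔m _ _)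

agreeAt : Bool → Bool → Bool → Bool
agreeAt false b a = true
agreeAt true  b a = does (b Bool.≟ a)

agreeOn : ∀ {k} → Subset k → Assignment k → Assignment k → Bool
agreeOn []      []      []      = true
agreeOn (s ∷ S) (b ∷ y) (a ∷ x) = agreeAt s b a ∧ agreeOn S y x

-- indicator S y is ∏ᵢ (factor₀ + factor₁ xᵢ), the factor being 1 for i ∉ S, xᵢ if yᵢ = 1
-- and 1 − xᵢ if yᵢ = 0.
factor₀ factor₁ : Bool → Bool → ℤ
factor₀ false b     = 1ℤ
factor₀ true  true  = 0ℤ
factor₀ true  false = 1ℤ
factor₁ false b     = 0ℤ
factor₁ true  true  = 1ℤ
factor₁ true  false = -1ℤ

factor-bit : ∀ s b a → factor₀ s b + factor₁ s b * bit a ≡ bit (agreeAt s b a)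
factor-bit false b     a     = refl
factor-bit true  true  true  = refl
factor-bit true  true  false = refl
factor-bit true  false true  = refl
factor-bit true  false false = refl

indicator : ∀ {k} → Subset k → Assignment k → Poly k
indicator []      []      []      = 1ℤ
indicator (s ∷ S) (b ∷ y) = mulAffine (factor₀ s b) (factor₁ s b) (indicator S y)

bit-∧ : ∀ u v → bit u * bit v ≡ bit (u ∧ v)
bit-∧ true  true  = refl
bit-∧ true  false = refl
bit-∧ false v     = refl

eval-indicator : ∀ {k} (S : Subset k) y x → eval (indicator S y) x ≡ bit (agreeOn S y x)
eval-indicator []      []      []      = refl
eval-indicator (s ∷ S) (b ∷ y) (a ∷ x) = begin
  eval (indicator (s ∷ S) (b ∷ y)) (a ∷ x)
    ≡⟨ eval-mulAffine (factor₀ s b) (factor₁ s b) (indicator S y) a x ⟩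
  (factor₀ s b + factor₁ s b * bit a) * eval (indicator S y) x
    ≡⟨ cong₂ _*_ (factor-bit s b a) (eval-indicator S y x) ⟩
  bit (agreeAt s b a) * bit (agreeOn S y x)
    ≡⟨ bit-∧ (agreeAt s b a) (agreeOn S y x) ⟩
  bit (agreeOn (s ∷ S) (b ∷ y) (a ∷ x)) ∎
  where open ≡-Reasoning

indicator-support : ∀ {k} (S : Subset k) y T → indicator S y T ≢ 0ℤ → T ⊆ S
tail-support : ∀ {k} s b (S : Subset k) y t T →
  indicator (s ∷ S) (b ∷ y) (t ∷ T) ≢ 0ℤ → T ⊆ S
tail-support s b S y t T nz =
  indicator-support S y T (mulAffine-coeff≢0 (factor₀ s b) (factor₁ s b) (indicator S y) t T nz)
indicator-support []          []      []          nz = ⊆-refl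
indicator-support (false ∷ S) (b ∷ y) (true  ∷ T) nz = ⊥-elim (nz refl)
indicator-support (false ∷ S) (b ∷ y) (false ∷ T) nz = out⊆ (tail-support false b S y false T nz)
indicator-support (true  ∷ S) (b ∷ y) (true  ∷ T) nz = s⊆s (tail-support true b S y true T nz)
indicator-support (true  ∷ S) (b ∷ y) (false ∷ T) nz = out⊆ (tail-support true b S y false T nz)

indicator-top≢0 : ∀ {k} (S : Subset k) y → indicator S y S ≢ 0ℤ
indicator-top≢0 []          []          = λ ()
indicator-top≢0 (false ∷ S) (b     ∷ y) = *-≢0 1ℤ _ (λ ()) (indicator-top≢0 S y)
indicator-top≢0 (true  ∷ S) (true  ∷ y) = *-≢0 1ℤ _ (λ ()) (indicator-top≢0 S y)
indicator-top≢0 (true  ∷ S) (false ∷ y) = *-≢0 -1ℤ _ (λ ()) (indicator-top≢0 S y)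

degree-indicator : ∀ {k} (S : Subset k) y → degree (indicator S y) ≡ ∣ S ∣
degree-indicator S y = ℕ.≤-antisym
  (degree≤ (indicator S y) (λ T nz → p⊆q⇒∣p∣≤∣q∣ (indicator-support S y T nz)))
  (≤degree (indicator S y) S (indicator-top≢0 S y))

agreeOn-refl : ∀ {k} (S : Subset k) y → agreeOn S y y ≡ true
agreeOn-refl []          []          = refl
agreeOn-refl (false ∷ S) (b     ∷ y) = agreeOn-refl S y
agreeOn-refl (true  ∷ S) (true  ∷ y) = agreeOn-refl S y
agreeOn-refl (true  ∷ S) (false ∷ y) = agreeOn-refl S y

agreeOn-subcube⇒≡ : ∀ {k} (S : Subset k) c y x →
  agreeOn S y x ≡ true → Agrees S c x → Agrees S c y → x ≡ y
agreeOn-subcube⇒≡ []          []       []          []          _ _ _ = refl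
agreeOn-subcube⇒≡ (false ∷ S) (c₀ ∷ c) (b     ∷ y) (a     ∷ x) agree cx cy =
  cong₂ _∷_ (trans (cx fzero refl) (sym (cy fzero refl)))
            (agreeOn-subcube⇒≡ S c y x agree (cx ∘ fsuc) (cy ∘ fsuc))
agreeOn-subcube⇒≡ (true  ∷ S) (c₀ ∷ c) (true  ∷ y) (true  ∷ x) agree cx cy =
  cong (true ∷_) (agreeOn-subcube⇒≡ S c y x agree (cx ∘ fsuc) (cy ∘ fsuc))
agreeOn-subcube⇒≡ (true  ∷ S) (c₀ ∷ c) (false ∷ y) (false ∷ x) agree cx cy =
  cong (false ∷_) (agreeOn-subcube⇒≡ S c y x agree (cx ∘ fsuc) (cy ∘ fsuc))
agreeOn-subcube⇒≡ (true  ∷ S) (c₀ ∷ c) (true  ∷ y) (false ∷ x) () cx cy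
agreeOn-subcube⇒≡ (true  ∷ S) (c₀ ∷ c) (false ∷ y) (true  ∷ x) () cx cy

uniqueSat⇒agreeOn≡φ : ∀ {k} (φ : BoolFn k) S c (u : UniqueSat φ S c) x →
  Agrees S c x → agreeOn S (proj₁ u) x ≡ φ x
uniqueSat⇒agreeOn≡φ φ S c (y , (cy , φy) , unique) x cx = ⇔→≡ (mk⇔ to from)
  where
  to : agreeOn S y x ≡ true → φ x ≡ true
  to agree = subst (λ z → φ z ≡ true) (sym (agreeOn-subcube⇒≡ S c y x agree cx cy)) φy
  from : φ x ≡ true → agreeOn S y x ≡ true
  from φx = subst (λ z → agreeOn S y z ≡ true) (sym (unique x cx φx)) (agreeOn-refl S y)

uniqueSat⇒restrictionHasDegree : ∀ {k} (φ : BoolFn k) S c →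
  UniqueSat φ S c → RestrictionHasDegree φ S c ∣ S ∣
uniqueSat⇒restrictionHasDegree φ S c u@(y , _) =
  indicator S y ,
  (indicator-support S y ,
   λ x cx → trans (eval-indicator S y x) (cong bit (uniqueSat⇒agreeOn≡φ φ S c u x cx))) ,
  degree-indicator S y

andHardAt⇒degHardAt : ∀ {k} (φ : BoolFn k) h → AndHardAt φ h → DegHardAt φ h
andHardAt⇒degHardAt φ h andHard S ∣S∣≡h with andHard S ∣S∣≡h
... | c , u = c , subst (RestrictionHasDegree φ S c) ∣S∣≡h (uniqueSat⇒restrictionHasDegree φ S c u)

mainTheorem14 : (k : ℕ) (φ : BoolFn k) (a d : ℕ) →
    IsAndHardness φ a → IsDegHardness φ d → a ≤ d
mainTheorem14 k φ zero    d _                   _                 = z≤n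
mainTheorem14 k φ (suc a) d (const⇒0 , largest) (_ , _ , maximal) =
  maximal (suc a) a≤k (andHardAt⇒degHardAt φ (suc a) andHard)
  where
  nonconstant : ¬ IsConstant φ
  nonconstant constant with const⇒0 constant
  ... | ()
  a≤k : suc a ≤ k
  a≤k = proj₁ (largest nonconstant)
  andHard : AndHardAt φ (suc a)
  andHard = proj₁ (proj₂ (largest nonconstant))
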